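{- Cut elimination for simple proof nets preserves correctness, is confluent, and is terminating.
   Context: Work in unit-free classical propositional logic with formulas generated by $F ::= a \mid \bar a \mid F\vee F \mid F\wedge F$ ($a$ ranging over propositional variables, $\bar a$ their duals, negation pushed to atoms). A cut is treated as a special formula $A \mathbin{\text{cut}} \bar A$ occurring only at the root of a tree. A simple prenet $\pi$ consists of a sequent forest $\Gamma$ (a list of formula trees, possibly including cuts) together with a symmetric, irreflexive binary relation $P$ (the identity links) on its set of leaves (atom occurrences) such that any two related atom occurrences are dual to each other; an atom may be linked to zero, one, or several others, but there is at most one link between any pair. A conjunctive pruning of $\pi$ is obtained by deleting, for every $\wedge$-node and every cut, one of its two immediate subformulas, and restricting $P$ to the remaining leaves. A simple prenet is correct (obeys the pruning condition) iff every conjunctive pruning still contains at least one identity link; correct simple prenets are called simple proof nets. Cut elimination on simple prenets is given by the following reductions: (1) a cut between $A\wedge B$ and $\bar B\vee\bar A$ is replaced by two cuts, one between $A$ and $\bar A$ and one between $B$ and $\bar B$; (2) an atomic cut between $a$ and $\bar a$ is removed, and every atom $\bar a$ linked to the cut occurrence of $a$ becomes linked to every atom $a$ linked to the cut occurrence of $\bar a$ (if one of the cut atoms has no links, no new links arise; a link between the two cut atoms themselves is simply removed with the cut). -}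

module Defs where

open import Data.Nat using (ℕ)
open import Data.Bool using (Bool; true; false; _∨_; _∧_)
open import Data.Empty using (⊥)
open import Data.Unit using (⊤)
open import Data.Sum using (_⊎_; inj₁; inj₂; [_,_]′)
open import Data.Product using (_×_; _,_; ∃; ∃-syntax; Σ-syntax)
open import Data.List using (List; []; _∷_; _++_)
open import Function using (_∘_)
open import Relation.Binary.PropositionalEquality using (_≡_; subst)
open import Relation.Binary.Construct.Closure.ReflexiveTransitive using (Star)
open import Induction.WellFounded using (Acc)

data Lit : Set where
  pos : ℕ → Lit
  neg : ℕ → Lit

dualLit : Lit → Lit
dualLit (pos a) = neg a
dualLit (neg a) = pos a

data Formula : Set where
  lit   : Lit → Formula
  _∨ᶠ_  : Formula → Formula → Formula
  _∧ᶠ_  : Formula → Formula → Formula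

-- De Morgan dual (planar: the dual of A ∧ B is B̄ ∨ Ā)
dual : Formula → Formula
dual (lit l)  = lit (dualLit l)
dual (A ∨ᶠ B) = dual B ∧ᶠ dual A
dual (A ∧ᶠ B) = dual B ∨ᶠ dual A

data Leaf : Formula → Set where
  here : ∀ {l} → Leaf (lit l)
  ∨l   : ∀ {A B} → Leaf A → Leaf (A ∨ᶠ B)
  ∨r   : ∀ {A B} → Leaf B → Leaf (A ∨ᶠ B)
  ∧l   : ∀ {A B} → Leaf A → Leaf (A ∧ᶠ B)
  ∧r   : ∀ {A B} → Leaf B → Leaf (A ∧ᶠ B)

label : ∀ {F} → Leaf F → Lit
label (here {l}) = l
label (∨l x) = label x
label (∨r x) = label x
label (∧l x) = label x
label (∧r x) = label x

data Tree : Set where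
  fml : Formula → Tree
  cut : Formula → Tree        -- cut A  is the tree  A cut Ā

TLeaf : Tree → Set
TLeaf (fml F) = Leaf F
TLeaf (cut A) = Leaf A ⊎ Leaf (dual A)

tlabel : ∀ t → TLeaf t → Lit
tlabel (fml F) x = label x
tlabel (cut A) (inj₁ x) = label x
tlabel (cut A) (inj₂ x) = label x

Forest : Set
Forest = List Tree

FLeaf : Forest → Set
FLeaf []      = ⊥
FLeaf (t ∷ Γ) = TLeaf t ⊎ FLeaf Γ

flabel : ∀ Γ → FLeaf Γ → Lit
flabel (t ∷ Γ) (inj₁ x) = tlabel t x
flabel (t ∷ Γ) (inj₂ x) = flabel Γ x

-- (Raw) prenets: a forest with a Bool-valued link relation on leaves
-- (a relation, so at most one link between any pair)

record Prenet : Set where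
  constructor mk
  field
    Γ : Forest
    P : FLeaf Γ → FLeaf Γ → Bool
open Prenet public

IsSimple : Prenet → Set
IsSimple π =
  (∀ x y → P π x y ≡ P π y x) ×
  (∀ x → P π x x ≡ false) ×
  (∀ x y → P π x y ≡ true → flabel (Γ π) y ≡ dualLit (flabel (Γ π) x))

-- Conjunctive prunings: at every ∧-node and every cut, keep one side

Pruning : Formula → Set
Pruning (lit l)  = ⊤
Pruning (A ∨ᶠ B) = Pruning A × Pruning B
Pruning (A ∧ᶠ B) = Pruning A ⊎ Pruning B

kept : ∀ {F} → Pruning F → Leaf F → Set
kept p here = ⊤
kept (p , q) (∨l x) = kept p x
kept (p , q) (∨r x) = kept q x
kept (inj₁ p) (∧l x) = kept p x
kept (inj₂ q) (∧l x) = ⊥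
kept (inj₁ p) (∧r x) = ⊥
kept (inj₂ q) (∧r x) = kept q x

TPruning : Tree → Set
TPruning (fml F) = Pruning F
TPruning (cut A) = Pruning A ⊎ Pruning (dual A)

tkept : ∀ t → TPruning t → TLeaf t → Set
tkept (fml F) p x = kept p x
tkept (cut A) (inj₁ p) (inj₁ x) = kept p x
tkept (cut A) (inj₁ p) (inj₂ x) = ⊥
tkept (cut A) (inj₂ p) (inj₁ x) = ⊥
tkept (cut A) (inj₂ p) (inj₂ x) = kept p x

FPruning : Forest → Set
FPruning []      = ⊤
FPruning (t ∷ Γ) = TPruning t × FPruning Γ

fkept : ∀ Γ → FPruning Γ → FLeaf Γ → Set
fkept (t ∷ Γ) (p , ps) (inj₁ x) = tkept t p x
fkept (t ∷ Γ) (p , ps) (inj₂ x) = fkept Γ ps x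

Correct : Prenet → Set
Correct π = ∀ (p : FPruning (Γ π)) →
  ∃[ x ] ∃[ y ] (fkept (Γ π) p x × fkept (Γ π) p y × P π x y ≡ true)

SimpleProofNet : Prenet → Set
SimpleProofNet π = IsSimple π × Correct π

appL : ∀ Δ Γ → FLeaf Δ → FLeaf (Δ ++ Γ)
appL (t ∷ Δ) Γ (inj₁ x) = inj₁ x
appL (t ∷ Δ) Γ (inj₂ x) = inj₂ (appL Δ Γ x)

appR : ∀ Δ Γ → FLeaf Γ → FLeaf (Δ ++ Γ)
appR []      Γ x = x
appR (t ∷ Δ) Γ x = inj₂ (appR Δ Γ x)

split : ∀ Δ Γ → FLeaf (Δ ++ Γ) → FLeaf Δ ⊎ FLeaf Γ
split []      Γ x = inj₂ x
split (t ∷ Δ) Γ (inj₁ x) = inj₁ (inj₁ x)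
split (t ∷ Δ) Γ (inj₂ x) with split Δ Γ x
... | inj₁ y = inj₁ (inj₂ y)
... | inj₂ z = inj₂ z

frame : ∀ Γ₁ Δ' Δ Γ₂ → (FLeaf Δ' → FLeaf Δ) →
        FLeaf (Γ₁ ++ Δ' ++ Γ₂) → FLeaf (Γ₁ ++ Δ ++ Γ₂)
frame [] Δ' Δ Γ₂ f x = [ appL Δ Γ₂ ∘ f , appR Δ Γ₂ ]′ (split Δ' Γ₂ x)
frame (t ∷ Γ₁) Δ' Δ Γ₂ f (inj₁ x) = inj₁ x
frame (t ∷ Γ₁) Δ' Δ Γ₂ f (inj₂ x) = inj₂ (frame Γ₁ Δ' Δ Γ₂ f x)

ι∧ : ∀ A B → FLeaf (cut A ∷ cut B ∷ []) → FLeaf (cut (A ∧ᶠ B) ∷ [])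
ι∧ A B (inj₁ (inj₁ x)) = inj₁ (inj₁ (∧l x))
ι∧ A B (inj₁ (inj₂ x)) = inj₁ (inj₂ (∨r x))
ι∧ A B (inj₂ (inj₁ (inj₁ y))) = inj₁ (inj₁ (∧r y))
ι∧ A B (inj₂ (inj₁ (inj₂ y))) = inj₁ (inj₂ (∨l y))

ι∨ : ∀ A B → FLeaf (cut A ∷ cut B ∷ []) → FLeaf (cut (A ∨ᶠ B) ∷ [])
ι∨ A B (inj₁ (inj₁ x)) = inj₁ (inj₁ (∨l x))
ι∨ A B (inj₁ (inj₂ x)) = inj₁ (inj₂ (∧r x))
ι∨ A B (inj₂ (inj₁ (inj₁ y))) = inj₁ (inj₁ (∨r y))
ι∨ A B (inj₂ (inj₁ (inj₂ y))) = inj₁ (inj₂ (∧l y))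

ι∅ : ∀ {Δ} → FLeaf [] → FLeaf Δ
ι∅ ()

at : ∀ Γ₁ t Γ₂ → TLeaf t → FLeaf (Γ₁ ++ t ∷ Γ₂)
at []       t Γ₂ x = inj₁ x
at (s ∷ Γ₁) t Γ₂ x = inj₂ (at Γ₁ t Γ₂ x)

data _⟶_ : Prenet → Prenet → Set where
  -- (1) a cut between A ∧ B and B̄ ∨ Ā becomes cuts A cut Ā and B cut B̄
  ∧-red : ∀ Γ₁ Γ₂ A B (Q : FLeaf (Γ₁ ++ cut (A ∧ᶠ B) ∷ Γ₂) → FLeaf (Γ₁ ++ cut (A ∧ᶠ B) ∷ Γ₂) → Bool) →
    mk (Γ₁ ++ cut (A ∧ᶠ B) ∷ Γ₂) Q ⟶
    mk (Γ₁ ++ cut A ∷ cut B ∷ Γ₂)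
       (λ x y → Q (frame Γ₁ _ (cut (A ∧ᶠ B) ∷ []) Γ₂ (ι∧ A B) x)
                  (frame Γ₁ _ (cut (A ∧ᶠ B) ∷ []) Γ₂ (ι∧ A B) y))
  -- (1) same rule for a cut written with the disjunction on the left
  ∨-red : ∀ Γ₁ Γ₂ A B (Q : FLeaf (Γ₁ ++ cut (A ∨ᶠ B) ∷ Γ₂) → FLeaf (Γ₁ ++ cut (A ∨ᶠ B) ∷ Γ₂) → Bool) →
    mk (Γ₁ ++ cut (A ∨ᶠ B) ∷ Γ₂) Q ⟶
    mk (Γ₁ ++ cut A ∷ cut B ∷ Γ₂)
       (λ x y → Q (frame Γ₁ _ (cut (A ∨ᶠ B) ∷ []) Γ₂ (ι∨ A B) x)
                  (frame Γ₁ _ (cut (A ∨ᶠ B) ∷ []) Γ₂ (ι∨ A B) y))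
  -- (2) an atomic cut a cut ā is removed; atoms linked to the cut a get
  --     linked to atoms linked to the cut ā (in both directions)
  atom-red : ∀ Γ₁ Γ₂ l (Q : FLeaf (Γ₁ ++ cut (lit l) ∷ Γ₂) → FLeaf (Γ₁ ++ cut (lit l) ∷ Γ₂) → Bool) →
    let ι  = frame Γ₁ [] (cut (lit l) ∷ []) Γ₂ ι∅
        c₁ = at Γ₁ (cut (lit l)) Γ₂ (inj₁ here)
        c₂ = at Γ₁ (cut (lit l)) Γ₂ (inj₂ here)
    in mk (Γ₁ ++ cut (lit l) ∷ Γ₂) Q ⟶
       mk (Γ₁ ++ Γ₂)
          (λ x y → Q (ι x) (ι y)
                   ∨ (Q (ι x) c₁ ∧ Q c₂ (ι y))
                   ∨ (Q (ι x) c₂ ∧ Q c₁ (ι y)))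

_⟶*_ : Prenet → Prenet → Set
_⟶*_ = Star _⟶_

_≈_ : Prenet → Prenet → Set
π ≈ ρ = Σ[ e ∈ Γ π ≡ Γ ρ ] (∀ x y → P π x y ≡ P ρ (subst FLeaf e x) (subst FLeaf e y))

StronglyNormalizing : Prenet → Set
StronglyNormalizing = Acc (λ ρ σ → σ ⟶ ρ)

-- A cut  A cut Ā  pairs each leaf of A with its mirror image in Ā; a path of a
-- prenet is an alternating sequence  link, crossing of a cut, link, …, link.
-- Each step is simulated by a map from the leaves of the reduct into those of
-- the redex which preserves and reflects paths between leaves outside cuts: the
-- binary rules only regroup the leaves of a cut, and the atomic rule turns a
-- detour through the removed cut into one of the new links (irreflexivity keeps
-- a path from bouncing on a cut atom). In a cut-free net paths are just links,
-- so every normal form reachable from π has exactly the paths of π as links, and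
-- any two of them coincide. Normal forms exist because each step decreases the
-- total size of the cut formulas, which is also why reduction terminates.
-- Correctness is preserved because every pruning of the reduct is dominated by a
-- pruning of the redex; for an atomic cut, by the two prunings choosing either
-- side of the cut, whose links through the cut combine into a new link.
module Submission where

open import Defs
open import Data.Bool using (Bool; true; false; _∨_; _∧_)
open import Data.Bool.Properties using (∨-comm; ∨-zeroʳ; ∧-comm; ∧-conicalˡ; ∧-conicalʳ)
open import Data.Empty using (⊥; ⊥-elim)
open import Data.List using ([]; _∷_; _++_)
open import Data.Nat using (ℕ; suc; _+_; _<_; s≤s)
open import Data.Nat.Induction using (<-wellFounded)
open import Data.Nat.Properties using (+-monoʳ-<; n<1+n; ≤-reflexive; +-assoc)
open import Data.Product using (_×_; ∃-syntax; Σ-syntax; _,_; proj₁; proj₂)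
open import Data.Sum using (_⊎_; inj₁; inj₂)
open import Data.Unit using (⊤; tt)
open import Function using (id; _∘_)
open import Function.Bundles using (_⇔_; mk⇔; Equivalence)
open import Function.Construct.Identity using (⇔-id)
open import Induction.WellFounded using (acc; module Subrelation)
open import Relation.Binary.Construct.Closure.ReflexiveTransitive using (ε; _◅_; _◅◅_)
open import Relation.Binary.Construct.On using (wellFounded)
open import Relation.Binary.PropositionalEquality
open import Relation.Nullary using (¬_)

dualLit-involutive : ∀ l → dualLit (dualLit l) ≡ l
dualLit-involutive (pos a) = refl
dualLit-involutive (neg a) = refl

dualLit-injective : ∀ {l m} → dualLit l ≡ dualLit m → l ≡ m
dualLit-injective {l} {m} e =
  trans (sym (dualLit-involutive l)) (trans (cong dualLit e) (dualLit-involutive m))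

l≢dualLit : ∀ l → l ≢ dualLit l
l≢dualLit (pos a) ()
l≢dualLit (neg a) ()

true≢false : true ≢ false
true≢false ()

∨-true⁻ : ∀ a {b} → a ∨ b ≡ true → a ≡ true ⊎ b ≡ true
∨-true⁻ true  _ = inj₁ refl
∨-true⁻ false h = inj₂ h

∨-trueˡ : ∀ {a} b → a ≡ true → a ∨ b ≡ true
∨-trueˡ b refl = refl

∧-false : ∀ b c → (b ≡ true → c ≡ true → ⊥) → b ∧ c ≡ false
∧-false true  true  h = ⊥-elim (h refl refl)
∧-false true  false h = refl
∧-false false c     h = refl

≡true-⇔⇒≡ : ∀ {a b} → (a ≡ true → b ≡ true) → (b ≡ true → a ≡ true) → a ≡ b
≡true-⇔⇒≡ {true}  {true}  f g = refl
≡true-⇔⇒≡ {true}  {false} f g = sym (f refl)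
≡true-⇔⇒≡ {false} {true}  f g = g refl
≡true-⇔⇒≡ {false} {false} f g = refl

-- The shape  a ∨ b ∧ c ∨ d ∧ e  is that of the links created by an atomic cut step.
∨∧∨-true⁻ : ∀ a b c d e → a ∨ b ∧ c ∨ d ∧ e ≡ true →
            a ≡ true ⊎ (b ≡ true × c ≡ true) ⊎ (d ≡ true × e ≡ true)
∨∧∨-true⁻ a b c d e h with ∨-true⁻ a h
... | inj₁ ha = inj₁ ha
... | inj₂ h′ with ∨-true⁻ (b ∧ c) h′
...   | inj₁ hbc = inj₂ (inj₁ (∧-conicalˡ b c hbc , ∧-conicalʳ b c hbc))
...   | inj₂ hde = inj₂ (inj₂ (∧-conicalˡ d e hde , ∧-conicalʳ d e hde))

∨∧∨-true₂ : ∀ a {b c} r → b ≡ true → c ≡ true → a ∨ b ∧ c ∨ r ≡ true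
∨∧∨-true₂ a r refl refl = ∨-zeroʳ a

∨∧∨-true₃ : ∀ a s {d e} → d ≡ true → e ≡ true → a ∨ s ∨ d ∧ e ≡ true
∨∧∨-true₃ a s refl refl = trans (cong (a ∨_) (∨-zeroʳ s)) (∨-zeroʳ a)

∨∧∨-swap : ∀ a b c d e → a ∨ b ∧ c ∨ d ∧ e ≡ a ∨ e ∧ d ∨ c ∧ b
∨∧∨-swap a b c d e =
  cong (a ∨_) (trans (∨-comm (b ∧ c) (d ∧ e)) (cong₂ _∨_ (∧-comm d e) (∧-comm b c)))

subst-∷-inj₁ : ∀ {t Γ Γ′} (e : Γ ≡ Γ′) (x : TLeaf t) →
               subst FLeaf (cong (t ∷_) e) (inj₁ x) ≡ inj₁ x
subst-∷-inj₁ refl x = refl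

subst-∷-inj₂ : ∀ {t Γ Γ′} (e : Γ ≡ Γ′) (y : FLeaf Γ) →
               subst FLeaf (cong (t ∷_) e) (inj₂ y) ≡ inj₂ (subst FLeaf e y)
subst-∷-inj₂ refl y = refl

-- Cut crossings and paths

Mirror : ∀ A → Leaf A → Leaf (dual A) → Set
Mirror (lit l)  here   here   = ⊤
Mirror (A ∨ᶠ B) (∨l x) (∧l y) = ⊥
Mirror (A ∨ᶠ B) (∨l x) (∧r y) = Mirror A x y
Mirror (A ∨ᶠ B) (∨r x) (∧l y) = Mirror B x y
Mirror (A ∨ᶠ B) (∨r x) (∧r y) = ⊥
Mirror (A ∧ᶠ B) (∧l x) (∨l y) = ⊥
Mirror (A ∧ᶠ B) (∧l x) (∨r y) = Mirror A x y
Mirror (A ∧ᶠ B) (∧r x) (∨l y) = Mirror B x y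
Mirror (A ∧ᶠ B) (∧r x) (∨r y) = ⊥

TCross : ∀ t → TLeaf t → TLeaf t → Set
TCross (fml F) _        _        = ⊥
TCross (cut A) (inj₁ x) (inj₂ y) = Mirror A x y
TCross (cut A) (inj₂ y) (inj₁ x) = Mirror A x y
TCross (cut A) (inj₁ _) (inj₁ _) = ⊥
TCross (cut A) (inj₂ _) (inj₂ _) = ⊥

Cross : ∀ Γ → FLeaf Γ → FLeaf Γ → Set
Cross (t ∷ Γ) (inj₁ x) (inj₁ y) = TCross t x y
Cross (t ∷ Γ) (inj₁ x) (inj₂ y) = ⊥
Cross (t ∷ Γ) (inj₂ x) (inj₁ y) = ⊥
Cross (t ∷ Γ) (inj₂ x) (inj₂ y) = Cross Γ x y

data Path {L : Set} (Q : L → L → Bool) (C : L → L → Set) : L → L → Set where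
  link       : ∀ {x y} → Q x y ≡ true → Path Q C x y
  link-cross : ∀ {x z z′ y} → Q x z ≡ true → C z z′ → Path Q C z′ y → Path Q C x y

NetPath : (π : Prenet) → FLeaf (Γ π) → FLeaf (Γ π) → Set
NetPath π = Path (P π) (Cross (Γ π))

outer : Forest → Forest
outer []          = []
outer (fml F ∷ Γ) = fml F ∷ outer Γ
outer (cut A ∷ Γ) = outer Γ

embOuter : ∀ Γ → FLeaf (outer Γ) → FLeaf Γ
embOuter (fml F ∷ Γ) (inj₁ x) = inj₁ x
embOuter (fml F ∷ Γ) (inj₂ o) = inj₂ (embOuter Γ o)
embOuter (cut A ∷ Γ) o        = inj₂ (embOuter Γ o)

data CutFree : Forest → Set where
  []  : CutFree []
  _∷_ : ∀ F {Γ} → CutFree Γ → CutFree (fml F ∷ Γ)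

module FrameLift (Δ′ Δ Θ : Forest) (f : FLeaf Δ′ → FLeaf Δ) where

  frame-label : (∀ w → flabel (Δ ++ Θ) (frame [] Δ′ Δ Θ f w) ≡ flabel (Δ′ ++ Θ) w) →
                ∀ Γ₁ x → flabel (Γ₁ ++ Δ ++ Θ) (frame Γ₁ Δ′ Δ Θ f x) ≡ flabel (Γ₁ ++ Δ′ ++ Θ) x
  frame-label base []       x        = base x
  frame-label base (t ∷ Γ₁) (inj₁ x) = refl
  frame-label base (t ∷ Γ₁) (inj₂ x) = frame-label base Γ₁ x

  frame-cross : (∀ w w′ → Cross (Δ ++ Θ) (frame [] Δ′ Δ Θ f w) (frame [] Δ′ Δ Θ f w′) ≡ Cross (Δ′ ++ Θ) w w′) →
                ∀ Γ₁ x y → Cross (Γ₁ ++ Δ ++ Θ) (frame Γ₁ Δ′ Δ Θ f x) (frame Γ₁ Δ′ Δ Θ f y)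
                           ≡ Cross (Γ₁ ++ Δ′ ++ Θ) x y
  frame-cross base []       x        y        = base x y
  frame-cross base (t ∷ Γ₁) (inj₁ x) (inj₁ y) = refl
  frame-cross base (t ∷ Γ₁) (inj₁ x) (inj₂ y) = refl
  frame-cross base (t ∷ Γ₁) (inj₂ x) (inj₁ y) = refl
  frame-cross base (t ∷ Γ₁) (inj₂ x) (inj₂ y) = frame-cross base Γ₁ x y

  outer-frame : outer (Δ′ ++ Θ) ≡ outer (Δ ++ Θ) →
                ∀ Γ₁ → outer (Γ₁ ++ Δ′ ++ Θ) ≡ outer (Γ₁ ++ Δ ++ Θ)
  outer-frame e []            = e
  outer-frame e (fml F ∷ Γ₁) = cong (fml F ∷_) (outer-frame e Γ₁)
  outer-frame e (cut A ∷ Γ₁) = outer-frame e Γ₁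

  frame-embOuter : (e : outer (Δ′ ++ Θ) ≡ outer (Δ ++ Θ)) →
                   (∀ o → frame [] Δ′ Δ Θ f (embOuter _ o) ≡ embOuter _ (subst FLeaf e o)) →
                   ∀ Γ₁ o → frame Γ₁ Δ′ Δ Θ f (embOuter _ o)
                            ≡ embOuter _ (subst FLeaf (outer-frame e Γ₁) o)
  frame-embOuter e base [] o = base o
  frame-embOuter e base (fml F ∷ Γ₁) (inj₁ x)
    rewrite subst-∷-inj₁ {fml F} (outer-frame e Γ₁) x = refl
  frame-embOuter e base (fml F ∷ Γ₁) (inj₂ o)
    rewrite subst-∷-inj₂ {fml F} (outer-frame e Γ₁) o = cong inj₂ (frame-embOuter e base Γ₁ o)
  frame-embOuter e base (cut A ∷ Γ₁) o = cong inj₂ (frame-embOuter e base Γ₁ o)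

frame-inverse : ∀ {Δ′ Δ Θ} (f : FLeaf Δ′ → FLeaf Δ) (g : FLeaf Δ → FLeaf Δ′) →
                (∀ w → frame [] Δ′ Δ Θ f (frame [] Δ Δ′ Θ g w) ≡ w) →
                ∀ Γ₁ z → frame Γ₁ Δ′ Δ Θ f (frame Γ₁ Δ Δ′ Θ g z) ≡ z
frame-inverse f g base []       z        = base z
frame-inverse f g base (t ∷ Γ₁) (inj₁ x) = refl
frame-inverse f g base (t ∷ Γ₁) (inj₂ x) = cong inj₂ (frame-inverse f g base Γ₁ x)

module PathBijection {L′ L : Set} (Q : L → L → Bool) (C : L → L → Set) (C′ : L′ → L′ → Set)
  (f : L′ → L) (g : L → L′) (f∘g : ∀ z → f (g z) ≡ z) (g∘f : ∀ x → g (f x) ≡ x)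
  (cross-f : ∀ x y → C′ x y ≡ C (f x) (f y)) where

  Q′ : L′ → L′ → Bool
  Q′ x y = Q (f x) (f y)

  to : ∀ {x y} → Path Q′ C′ x y → Path Q C (f x) (f y)
  to (link h)         = link h
  to (link-cross h c p) = link-cross h (subst id (cross-f _ _) c) (to p)

  from-any : ∀ {s y} → Path Q C s (f y) → Path Q′ C′ (g s) y
  from-any {s} {y} (link h) = link (subst (λ u → Q u (f y) ≡ true) (sym (f∘g s)) h)
  from-any (link-cross {x = s} {z} {z′} h c p) =
    link-cross (subst₂ (λ u v → Q u v ≡ true) (sym (f∘g s)) (sym (f∘g z)) h)
               (subst id (sym (cross-f (g z) (g z′))) (subst₂ C (sym (f∘g z)) (sym (f∘g z′)) c))
               (from-any p)

  from : ∀ {x y} → Path Q C (f x) (f y) → Path Q′ C′ x y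
  from {x} {y} p = subst (λ u → Path Q′ C′ u y) (g∘f x) (from-any p)

-- Paths through an atomic cut  c₁ cut c₂  versus paths after removing it.
module AtomicCutPaths {L′ L : Set} (Q : L → L → Bool) (C : L → L → Set) (C′ : L′ → L′ → Set)
  (ι : L′ → L) (c₁ c₂ : L)
  (leaf-view : ∀ z → (Σ[ b ∈ L′ ] ι b ≡ z) ⊎ (z ≡ c₁) ⊎ (z ≡ c₂))
  (c₁-cross : ∀ z → C c₁ z → z ≡ c₂) (c₂-cross : ∀ z → C c₂ z → z ≡ c₁)
  (c₁-cross-c₂ : C c₁ c₂) (c₂-cross-c₁ : C c₂ c₁)
  (ι-cross⁻ : ∀ a z → C (ι a) z → Σ[ b ∈ L′ ] ι b ≡ z × C′ a b)
  (ι-cross : ∀ a b → C′ a b → C (ι a) (ι b))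
  (irrefl₁ : Q c₁ c₁ ≡ false) (irrefl₂ : Q c₂ c₂ ≡ false) where

  Q′ : L′ → L′ → Bool
  Q′ x y = Q (ι x) (ι y) ∨ (Q (ι x) c₁ ∧ Q c₂ (ι y)) ∨ (Q (ι x) c₂ ∧ Q c₁ (ι y))

  to : ∀ {a b} → Path Q′ C′ a b → Path Q C (ι a) (ι b)
  to (link h) with ∨∧∨-true⁻ _ _ _ _ _ h
  ... | inj₁ h₀              = link h₀
  ... | inj₂ (inj₁ (h₁ , h₂)) = link-cross h₁ c₁-cross-c₂ (link h₂)
  ... | inj₂ (inj₂ (h₁ , h₂)) = link-cross h₁ c₂-cross-c₁ (link h₂)
  to (link-cross h c p) with ∨∧∨-true⁻ _ _ _ _ _ h
  ... | inj₁ h₀              = link-cross h₀ (ι-cross _ _ c) (to p)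
  ... | inj₂ (inj₁ (h₁ , h₂)) = link-cross h₁ c₁-cross-c₂ (link-cross h₂ (ι-cross _ _ c) (to p))
  ... | inj₂ (inj₂ (h₁ , h₂)) = link-cross h₁ c₂-cross-c₁ (link-cross h₂ (ι-cross _ _ c) (to p))

  Continues : L′ → L′ → Set
  Continues w v = w ≡ v ⊎ Σ[ u ∈ L′ ] C′ w u × Path Q′ C′ u v

  link-continues : ∀ {s w v} → Q′ s w ≡ true → Continues w v → Path Q′ C′ s v
  link-continues h (inj₁ refl)        = link h
  link-continues h (inj₂ (u , c , p)) = link-cross h c p

  irrefl-absurd : ∀ {c} → Q c c ≡ false → Q c c ≡ true → ∀ {A : Set} → A
  irrefl-absurd ir h = ⊥-elim (true≢false (trans (sym h) ir))

  -- A path leaving a cut atom crosses back and forth through the cut until it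
  -- links to a leaf outside it; a link from a cut atom to itself is excluded.
  mutual
    from : ∀ {s v} → Path Q C (ι s) (ι v) → Path Q′ C′ s v
    from (link h) = link (∨-trueˡ _ h)
    from (link-cross {z = y} {z′ = y′} h c p) with leaf-view y
    ... | inj₁ (y₀ , refl) with ι-cross⁻ y₀ y′ c
    ...   | (y₁ , refl , c′) = link-cross (∨-trueˡ _ h) c′ (from p)
    from {s} (link-cross {z = y} {z′ = y′} h c p) | inj₂ (inj₁ refl) with c₁-cross y′ c
    ...   | refl with from-cut c₂ (inj₂ refl) p
    ...     | (w , hw , r) = link-continues (∨∧∨-true₂ (Q (ι s) (ι w)) _ h hw) r
    from {s} (link-cross {z = y} {z′ = y′} h c p) | inj₂ (inj₂ refl) with c₂-cross y′ c
    ...   | refl with from-cut c₁ (inj₁ refl) p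
    ...     | (w , hw , r) = link-continues (∨∧∨-true₃ (Q (ι s) (ι w)) _ h hw) r

    from-cut : ∀ z {v} → z ≡ c₁ ⊎ z ≡ c₂ → Path Q C z (ι v) →
               Σ[ w ∈ L′ ] Q z (ι w) ≡ true × Continues w v
    from-cut z {v} _ (link h) = v , h , inj₁ refl
    from-cut z _ (link-cross {z = y} {z′ = y′} h c p) with leaf-view y
    ... | inj₁ (y₀ , refl) with ι-cross⁻ y₀ y′ c
    ...   | (y₁ , refl , c′) = y₀ , h , inj₂ (y₁ , c′ , from p)
    from-cut z (inj₁ refl) (link-cross h c p) | inj₂ (inj₁ refl) = irrefl-absurd irrefl₁ h
    from-cut z (inj₂ refl) (link-cross {z′ = y′} h c p) | inj₂ (inj₁ refl) with c₁-cross y′ c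
    ... | refl = from-cut c₂ (inj₂ refl) p
    from-cut z (inj₂ refl) (link-cross h c p) | inj₂ (inj₂ refl) = irrefl-absurd irrefl₂ h
    from-cut z (inj₁ refl) (link-cross {z′ = y′} h c p) | inj₂ (inj₂ refl) with c₂-cross y′ c
    ... | refl = from-cut c₁ (inj₁ refl) p

record Simulation (π ρ : Prenet) : Set where
  field
    back          : FLeaf (Γ ρ) → FLeaf (Γ π)
    outer≡        : outer (Γ ρ) ≡ outer (Γ π)
    back-embOuter : ∀ o → back (embOuter _ o) ≡ embOuter _ (subst FLeaf outer≡ o)
    path-back     : ∀ {x y} → NetPath ρ x y → NetPath π (back x) (back y)
    path-forth    : ∀ {x y} → NetPath π (back x) (back y) → NetPath ρ x y

-- Binary cut steps

module BinaryCut (A B X : Formula)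
  (ι : FLeaf (cut A ∷ cut B ∷ []) → FLeaf (cut X ∷ []))
  (κ : FLeaf (cut X ∷ []) → FLeaf (cut A ∷ cut B ∷ []))
  (label-ι : ∀ Θ w → flabel (cut X ∷ Θ) (frame [] _ (cut X ∷ []) Θ ι w) ≡ flabel (cut A ∷ cut B ∷ Θ) w)
  (cross-ι : ∀ Θ w w′ → Cross (cut X ∷ Θ) (frame [] _ (cut X ∷ []) Θ ι w) (frame [] _ (cut X ∷ []) Θ ι w′)
                        ≡ Cross (cut A ∷ cut B ∷ Θ) w w′)
  (ι∘κ : ∀ Θ w → frame [] _ (cut X ∷ []) Θ ι (frame [] (cut X ∷ []) (cut A ∷ cut B ∷ []) Θ κ w) ≡ w)
  (κ∘ι : ∀ Θ w → frame [] (cut X ∷ []) (cut A ∷ cut B ∷ []) Θ κ (frame [] _ (cut X ∷ []) Θ ι w) ≡ w)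
  (merge : TPruning (cut A) → TPruning (cut B) → TPruning (cut X))
  (merge-kept : ∀ Θ pa pb ps w → fkept (cut X ∷ Θ) (merge pa pb , ps) w →
                fkept (cut A ∷ cut B ∷ Θ) (pa , pb , ps) (frame [] (cut X ∷ []) (cut A ∷ cut B ∷ []) Θ κ w))
  (Γ₁ Γ₂ : Forest) (Q : FLeaf (Γ₁ ++ cut X ∷ Γ₂) → FLeaf (Γ₁ ++ cut X ∷ Γ₂) → Bool) where

  new old : Forest
  new = cut A ∷ cut B ∷ []
  old = cut X ∷ []

  toOld : FLeaf (Γ₁ ++ new ++ Γ₂) → FLeaf (Γ₁ ++ old ++ Γ₂)
  toOld = frame Γ₁ new old Γ₂ ι

  toNew : FLeaf (Γ₁ ++ old ++ Γ₂) → FLeaf (Γ₁ ++ new ++ Γ₂)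
  toNew = frame Γ₁ old new Γ₂ κ

  π ρ : Prenet
  π = mk (Γ₁ ++ cut X ∷ Γ₂) Q
  ρ = mk (Γ₁ ++ new ++ Γ₂) (λ x y → Q (toOld x) (toOld y))

  open FrameLift new old Γ₂ ι

  label-toOld : ∀ x → flabel _ (toOld x) ≡ flabel _ x
  label-toOld = frame-label (label-ι Γ₂) Γ₁

  toOld∘toNew : ∀ z → toOld (toNew z) ≡ z
  toOld∘toNew = frame-inverse ι κ (ι∘κ Γ₂) Γ₁

  toNew∘toOld : ∀ z → toNew (toOld z) ≡ z
  toNew∘toOld = frame-inverse κ ι (κ∘ι Γ₂) Γ₁

  simple : IsSimple π → IsSimple ρ
  simple (sy , ir , lb) = (λ x y → sy (toOld x) (toOld y)) , (λ x → ir (toOld x)) ,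
    λ x y h → trans (sym (label-toOld y)) (trans (lb (toOld x) (toOld y) h) (cong dualLit (label-toOld x)))

  pruning-old : ∀ Γ₀ → FPruning (Γ₀ ++ new ++ Γ₂) → FPruning (Γ₀ ++ old ++ Γ₂)
  pruning-old []       (pa , pb , ps) = merge pa pb , ps
  pruning-old (t ∷ Γ₀) (q , ps)       = q , pruning-old Γ₀ ps

  pruning-old-kept : ∀ Γ₀ p z → fkept (Γ₀ ++ old ++ Γ₂) (pruning-old Γ₀ p) z →
                     fkept (Γ₀ ++ new ++ Γ₂) p (frame Γ₀ old new Γ₂ κ z)
  pruning-old-kept []       (pa , pb , ps) z        h = merge-kept Γ₂ pa pb ps z h
  pruning-old-kept (t ∷ Γ₀) (q , ps)       (inj₁ x) h = h
  pruning-old-kept (t ∷ Γ₀) (q , ps)       (inj₂ z) h = pruning-old-kept Γ₀ ps z h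

  correct : Correct π → Correct ρ
  correct c p with c (pruning-old Γ₁ p)
  ... | (z , w , kz , kw , h) =
    toNew z , toNew w , pruning-old-kept Γ₁ p z kz , pruning-old-kept Γ₁ p w kw ,
    subst₂ (λ u v → Q u v ≡ true) (sym (toOld∘toNew z)) (sym (toOld∘toNew w)) h

  open PathBijection Q (Cross _) (Cross _) toOld toNew toOld∘toNew toNew∘toOld
         (λ x y → sym (frame-cross (cross-ι Γ₂) Γ₁ x y)) using (to; from)

  simulation : Simulation π ρ
  simulation = record
    { back          = toOld
    ; outer≡        = outer-frame refl Γ₁
    ; back-embOuter = frame-embOuter refl (λ _ → refl) Γ₁
    ; path-back     = to
    ; path-forth    = from
    }

κ∧ : ∀ A B → FLeaf (cut (A ∧ᶠ B) ∷ []) → FLeaf (cut A ∷ cut B ∷ [])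
κ∧ A B (inj₁ (inj₁ (∧l a))) = inj₁ (inj₁ a)
κ∧ A B (inj₁ (inj₁ (∧r b))) = inj₂ (inj₁ (inj₁ b))
κ∧ A B (inj₁ (inj₂ (∨l b))) = inj₂ (inj₁ (inj₂ b))
κ∧ A B (inj₁ (inj₂ (∨r a))) = inj₁ (inj₂ a)

κ∨ : ∀ A B → FLeaf (cut (A ∨ᶠ B) ∷ []) → FLeaf (cut A ∷ cut B ∷ [])
κ∨ A B (inj₁ (inj₁ (∨l a))) = inj₁ (inj₁ a)
κ∨ A B (inj₁ (inj₁ (∨r b))) = inj₂ (inj₁ (inj₁ b))
κ∨ A B (inj₁ (inj₂ (∧l b))) = inj₂ (inj₁ (inj₂ b))
κ∨ A B (inj₁ (inj₂ (∧r a))) = inj₁ (inj₂ a)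

merge∧ : ∀ A B → TPruning (cut A) → TPruning (cut B) → TPruning (cut (A ∧ᶠ B))
merge∧ A B (inj₁ a) pb       = inj₁ (inj₁ a)
merge∧ A B (inj₂ a) (inj₁ b) = inj₁ (inj₂ b)
merge∧ A B (inj₂ a) (inj₂ b) = inj₂ (b , a)

merge∨ : ∀ A B → TPruning (cut A) → TPruning (cut B) → TPruning (cut (A ∨ᶠ B))
merge∨ A B (inj₁ a) (inj₁ b) = inj₁ (a , b)
merge∨ A B (inj₁ a) (inj₂ b) = inj₂ (inj₁ b)
merge∨ A B (inj₂ a) pb       = inj₂ (inj₂ a)

label-ι∧ : ∀ A B Θ w → flabel (cut (A ∧ᶠ B) ∷ Θ) (frame [] _ (cut (A ∧ᶠ B) ∷ []) Θ (ι∧ A B) w)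
             ≡ flabel (cut A ∷ cut B ∷ Θ) w
label-ι∧ A B Θ (inj₁ (inj₁ a)) = refl
label-ι∧ A B Θ (inj₁ (inj₂ a)) = refl
label-ι∧ A B Θ (inj₂ (inj₁ (inj₁ b))) = refl
label-ι∧ A B Θ (inj₂ (inj₁ (inj₂ b))) = refl
label-ι∧ A B Θ (inj₂ (inj₂ r)) = refl

cross-ι∧ : ∀ A B Θ w w′ → Cross (cut (A ∧ᶠ B) ∷ Θ) (frame [] _ (cut (A ∧ᶠ B) ∷ []) Θ (ι∧ A B) w)
                                    (frame [] _ (cut (A ∧ᶠ B) ∷ []) Θ (ι∧ A B) w′)
             ≡ Cross (cut A ∷ cut B ∷ Θ) w w′
cross-ι∧ A B Θ (inj₁ (inj₁ a)) (inj₁ (inj₁ a′)) = refl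
cross-ι∧ A B Θ (inj₁ (inj₁ a)) (inj₁ (inj₂ a′)) = refl
cross-ι∧ A B Θ (inj₁ (inj₁ a)) (inj₂ (inj₁ (inj₁ b′))) = refl
cross-ι∧ A B Θ (inj₁ (inj₁ a)) (inj₂ (inj₁ (inj₂ b′))) = refl
cross-ι∧ A B Θ (inj₁ (inj₁ a)) (inj₂ (inj₂ r′)) = refl
cross-ι∧ A B Θ (inj₁ (inj₂ a)) (inj₁ (inj₁ a′)) = refl
cross-ι∧ A B Θ (inj₁ (inj₂ a)) (inj₁ (inj₂ a′)) = refl
cross-ι∧ A B Θ (inj₁ (inj₂ a)) (inj₂ (inj₁ (inj₁ b′))) = refl
cross-ι∧ A B Θ (inj₁ (inj₂ a)) (inj₂ (inj₁ (inj₂ b′))) = refl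
cross-ι∧ A B Θ (inj₁ (inj₂ a)) (inj₂ (inj₂ r′)) = refl
cross-ι∧ A B Θ (inj₂ (inj₁ (inj₁ b))) (inj₁ (inj₁ a′)) = refl
cross-ι∧ A B Θ (inj₂ (inj₁ (inj₁ b))) (inj₁ (inj₂ a′)) = refl
cross-ι∧ A B Θ (inj₂ (inj₁ (inj₁ b))) (inj₂ (inj₁ (inj₁ b′))) = refl
cross-ι∧ A B Θ (inj₂ (inj₁ (inj₁ b))) (inj₂ (inj₁ (inj₂ b′))) = refl
cross-ι∧ A B Θ (inj₂ (inj₁ (inj₁ b))) (inj₂ (inj₂ r′)) = refl
cross-ι∧ A B Θ (inj₂ (inj₁ (inj₂ b))) (inj₁ (inj₁ a′)) = refl
cross-ι∧ A B Θ (inj₂ (inj₁ (inj₂ b))) (inj₁ (inj₂ a′)) = refl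
cross-ι∧ A B Θ (inj₂ (inj₁ (inj₂ b))) (inj₂ (inj₁ (inj₁ b′))) = refl
cross-ι∧ A B Θ (inj₂ (inj₁ (inj₂ b))) (inj₂ (inj₁ (inj₂ b′))) = refl
cross-ι∧ A B Θ (inj₂ (inj₁ (inj₂ b))) (inj₂ (inj₂ r′)) = refl
cross-ι∧ A B Θ (inj₂ (inj₂ r)) (inj₁ (inj₁ a′)) = refl
cross-ι∧ A B Θ (inj₂ (inj₂ r)) (inj₁ (inj₂ a′)) = refl
cross-ι∧ A B Θ (inj₂ (inj₂ r)) (inj₂ (inj₁ (inj₁ b′))) = refl
cross-ι∧ A B Θ (inj₂ (inj₂ r)) (inj₂ (inj₁ (inj₂ b′))) = refl
cross-ι∧ A B Θ (inj₂ (inj₂ r)) (inj₂ (inj₂ r′)) = refl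

ι∧∘κ∧ : ∀ A B Θ w → frame [] _ (cut (A ∧ᶠ B) ∷ []) Θ (ι∧ A B)
                      (frame [] (cut (A ∧ᶠ B) ∷ []) (cut A ∷ cut B ∷ []) Θ (κ∧ A B) w) ≡ w
ι∧∘κ∧ A B Θ (inj₁ (inj₁ (∧l a))) = refl
ι∧∘κ∧ A B Θ (inj₁ (inj₁ (∧r b))) = refl
ι∧∘κ∧ A B Θ (inj₁ (inj₂ (∨l b))) = refl
ι∧∘κ∧ A B Θ (inj₁ (inj₂ (∨r a))) = refl
ι∧∘κ∧ A B Θ (inj₂ r) = refl

κ∧∘ι∧ : ∀ A B Θ w → frame [] (cut (A ∧ᶠ B) ∷ []) (cut A ∷ cut B ∷ []) Θ (κ∧ A B)
                      (frame [] _ (cut (A ∧ᶠ B) ∷ []) Θ (ι∧ A B) w) ≡ w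
κ∧∘ι∧ A B Θ (inj₁ (inj₁ a)) = refl
κ∧∘ι∧ A B Θ (inj₁ (inj₂ a)) = refl
κ∧∘ι∧ A B Θ (inj₂ (inj₁ (inj₁ b))) = refl
κ∧∘ι∧ A B Θ (inj₂ (inj₁ (inj₂ b))) = refl
κ∧∘ι∧ A B Θ (inj₂ (inj₂ r)) = refl

label-ι∨ : ∀ A B Θ w → flabel (cut (A ∨ᶠ B) ∷ Θ) (frame [] _ (cut (A ∨ᶠ B) ∷ []) Θ (ι∨ A B) w)
             ≡ flabel (cut A ∷ cut B ∷ Θ) w
label-ι∨ A B Θ (inj₁ (inj₁ a)) = refl
label-ι∨ A B Θ (inj₁ (inj₂ a)) = refl
label-ι∨ A B Θ (inj₂ (inj₁ (inj₁ b))) = refl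
label-ι∨ A B Θ (inj₂ (inj₁ (inj₂ b))) = refl
label-ι∨ A B Θ (inj₂ (inj₂ r)) = refl

cross-ι∨ : ∀ A B Θ w w′ → Cross (cut (A ∨ᶠ B) ∷ Θ) (frame [] _ (cut (A ∨ᶠ B) ∷ []) Θ (ι∨ A B) w)
                                    (frame [] _ (cut (A ∨ᶠ B) ∷ []) Θ (ι∨ A B) w′)
             ≡ Cross (cut A ∷ cut B ∷ Θ) w w′
cross-ι∨ A B Θ (inj₁ (inj₁ a)) (inj₁ (inj₁ a′)) = refl
cross-ι∨ A B Θ (inj₁ (inj₁ a)) (inj₁ (inj₂ a′)) = refl
cross-ι∨ A B Θ (inj₁ (inj₁ a)) (inj₂ (inj₁ (inj₁ b′))) = refl
cross-ι∨ A B Θ (inj₁ (inj₁ a)) (inj₂ (inj₁ (inj₂ b′))) = refl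
cross-ι∨ A B Θ (inj₁ (inj₁ a)) (inj₂ (inj₂ r′)) = refl
cross-ι∨ A B Θ (inj₁ (inj₂ a)) (inj₁ (inj₁ a′)) = refl
cross-ι∨ A B Θ (inj₁ (inj₂ a)) (inj₁ (inj₂ a′)) = refl
cross-ι∨ A B Θ (inj₁ (inj₂ a)) (inj₂ (inj₁ (inj₁ b′))) = refl
cross-ι∨ A B Θ (inj₁ (inj₂ a)) (inj₂ (inj₁ (inj₂ b′))) = refl
cross-ι∨ A B Θ (inj₁ (inj₂ a)) (inj₂ (inj₂ r′)) = refl
cross-ι∨ A B Θ (inj₂ (inj₁ (inj₁ b))) (inj₁ (inj₁ a′)) = refl
cross-ι∨ A B Θ (inj₂ (inj₁ (inj₁ b))) (inj₁ (inj₂ a′)) = refl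
cross-ι∨ A B Θ (inj₂ (inj₁ (inj₁ b))) (inj₂ (inj₁ (inj₁ b′))) = refl
cross-ι∨ A B Θ (inj₂ (inj₁ (inj₁ b))) (inj₂ (inj₁ (inj₂ b′))) = refl
cross-ι∨ A B Θ (inj₂ (inj₁ (inj₁ b))) (inj₂ (inj₂ r′)) = refl
cross-ι∨ A B Θ (inj₂ (inj₁ (inj₂ b))) (inj₁ (inj₁ a′)) = refl
cross-ι∨ A B Θ (inj₂ (inj₁ (inj₂ b))) (inj₁ (inj₂ a′)) = refl
cross-ι∨ A B Θ (inj₂ (inj₁ (inj₂ b))) (inj₂ (inj₁ (inj₁ b′))) = refl
cross-ι∨ A B Θ (inj₂ (inj₁ (inj₂ b))) (inj₂ (inj₁ (inj₂ b′))) = refl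
cross-ι∨ A B Θ (inj₂ (inj₁ (inj₂ b))) (inj₂ (inj₂ r′)) = refl
cross-ι∨ A B Θ (inj₂ (inj₂ r)) (inj₁ (inj₁ a′)) = refl
cross-ι∨ A B Θ (inj₂ (inj₂ r)) (inj₁ (inj₂ a′)) = refl
cross-ι∨ A B Θ (inj₂ (inj₂ r)) (inj₂ (inj₁ (inj₁ b′))) = refl
cross-ι∨ A B Θ (inj₂ (inj₂ r)) (inj₂ (inj₁ (inj₂ b′))) = refl
cross-ι∨ A B Θ (inj₂ (inj₂ r)) (inj₂ (inj₂ r′)) = refl

ι∨∘κ∨ : ∀ A B Θ w → frame [] _ (cut (A ∨ᶠ B) ∷ []) Θ (ι∨ A B)
                      (frame [] (cut (A ∨ᶠ B) ∷ []) (cut A ∷ cut B ∷ []) Θ (κ∨ A B) w) ≡ w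
ι∨∘κ∨ A B Θ (inj₁ (inj₁ (∨l a))) = refl
ι∨∘κ∨ A B Θ (inj₁ (inj₁ (∨r b))) = refl
ι∨∘κ∨ A B Θ (inj₁ (inj₂ (∧l b))) = refl
ι∨∘κ∨ A B Θ (inj₁ (inj₂ (∧r a))) = refl
ι∨∘κ∨ A B Θ (inj₂ r) = refl

κ∨∘ι∨ : ∀ A B Θ w → frame [] (cut (A ∨ᶠ B) ∷ []) (cut A ∷ cut B ∷ []) Θ (κ∨ A B)
                      (frame [] _ (cut (A ∨ᶠ B) ∷ []) Θ (ι∨ A B) w) ≡ w
κ∨∘ι∨ A B Θ (inj₁ (inj₁ a)) = refl
κ∨∘ι∨ A B Θ (inj₁ (inj₂ a)) = refl
κ∨∘ι∨ A B Θ (inj₂ (inj₁ (inj₁ b))) = refl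
κ∨∘ι∨ A B Θ (inj₂ (inj₁ (inj₂ b))) = refl
κ∨∘ι∨ A B Θ (inj₂ (inj₂ r)) = refl
merge∧-kept : ∀ A B Θ pa pb ps w → fkept (cut (A ∧ᶠ B) ∷ Θ) (merge∧ A B pa pb , ps) w →
              fkept (cut A ∷ cut B ∷ Θ) (pa , pb , ps)
                    (frame [] (cut (A ∧ᶠ B) ∷ []) (cut A ∷ cut B ∷ []) Θ (κ∧ A B) w)
merge∧-kept A B Θ pa       pb       ps (inj₂ r)             h = h
merge∧-kept A B Θ (inj₁ _) pb       ps (inj₁ (inj₁ (∧l a))) h = h
merge∧-kept A B Θ (inj₁ _) pb       ps (inj₁ (inj₁ (∧r b))) ()
merge∧-kept A B Θ (inj₁ _) pb       ps (inj₁ (inj₂ (∨l b))) ()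
merge∧-kept A B Θ (inj₁ _) pb       ps (inj₁ (inj₂ (∨r a))) ()
merge∧-kept A B Θ (inj₂ _) (inj₁ _) ps (inj₁ (inj₁ (∧l a))) ()
merge∧-kept A B Θ (inj₂ _) (inj₁ _) ps (inj₁ (inj₁ (∧r b))) h = h
merge∧-kept A B Θ (inj₂ _) (inj₁ _) ps (inj₁ (inj₂ (∨l b))) ()
merge∧-kept A B Θ (inj₂ _) (inj₁ _) ps (inj₁ (inj₂ (∨r a))) ()
merge∧-kept A B Θ (inj₂ _) (inj₂ _) ps (inj₁ (inj₁ (∧l a))) ()
merge∧-kept A B Θ (inj₂ _) (inj₂ _) ps (inj₁ (inj₁ (∧r b))) ()
merge∧-kept A B Θ (inj₂ _) (inj₂ _) ps (inj₁ (inj₂ (∨l b))) h = h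
merge∧-kept A B Θ (inj₂ _) (inj₂ _) ps (inj₁ (inj₂ (∨r a))) h = h

merge∨-kept : ∀ A B Θ pa pb ps w → fkept (cut (A ∨ᶠ B) ∷ Θ) (merge∨ A B pa pb , ps) w →
              fkept (cut A ∷ cut B ∷ Θ) (pa , pb , ps)
                    (frame [] (cut (A ∨ᶠ B) ∷ []) (cut A ∷ cut B ∷ []) Θ (κ∨ A B) w)
merge∨-kept A B Θ pa       pb       ps (inj₂ r)             h = h
merge∨-kept A B Θ (inj₁ _) (inj₁ _) ps (inj₁ (inj₁ (∨l a))) h = h
merge∨-kept A B Θ (inj₁ _) (inj₁ _) ps (inj₁ (inj₁ (∨r b))) h = h
merge∨-kept A B Θ (inj₁ _) (inj₁ _) ps (inj₁ (inj₂ (∧l b))) ()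
merge∨-kept A B Θ (inj₁ _) (inj₁ _) ps (inj₁ (inj₂ (∧r a))) ()
merge∨-kept A B Θ (inj₁ _) (inj₂ _) ps (inj₁ (inj₁ (∨l a))) ()
merge∨-kept A B Θ (inj₁ _) (inj₂ _) ps (inj₁ (inj₁ (∨r b))) ()
merge∨-kept A B Θ (inj₁ _) (inj₂ _) ps (inj₁ (inj₂ (∧l b))) h = h
merge∨-kept A B Θ (inj₁ _) (inj₂ _) ps (inj₁ (inj₂ (∧r a))) ()
merge∨-kept A B Θ (inj₂ _) pb       ps (inj₁ (inj₁ (∨l a))) ()
merge∨-kept A B Θ (inj₂ _) pb       ps (inj₁ (inj₁ (∨r b))) ()
merge∨-kept A B Θ (inj₂ _) pb       ps (inj₁ (inj₂ (∧l b))) ()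
merge∨-kept A B Θ (inj₂ _) pb       ps (inj₁ (inj₂ (∧r a))) h = h

module ∧-Cut A B = BinaryCut A B (A ∧ᶠ B) (ι∧ A B) (κ∧ A B) (label-ι∧ A B) (cross-ι∧ A B)
                             (ι∧∘κ∧ A B) (κ∧∘ι∧ A B) (merge∧ A B) (merge∧-kept A B)
module ∨-Cut A B = BinaryCut A B (A ∨ᶠ B) (ι∨ A B) (κ∨ A B) (label-ι∨ A B) (cross-ι∨ A B)
                             (ι∨∘κ∨ A B) (κ∨∘ι∨ A B) (merge∨ A B) (merge∨-kept A B)

-- Atomic cut steps

module AtomicCutLeaves (l : Lit) (Γ₂ : Forest) where

  T : Tree
  T = cut (lit l)

  include : ∀ Γ₀ → FLeaf (Γ₀ ++ Γ₂) → FLeaf (Γ₀ ++ T ∷ Γ₂)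
  include Γ₀ = frame Γ₀ [] (T ∷ []) Γ₂ ι∅

  cutAtom cutDual : ∀ Γ₀ → FLeaf (Γ₀ ++ T ∷ Γ₂)
  cutAtom Γ₀ = at Γ₀ T Γ₂ (inj₁ here)
  cutDual Γ₀ = at Γ₀ T Γ₂ (inj₂ here)

  leaf-view : ∀ Γ₀ z → (Σ[ b ∈ FLeaf (Γ₀ ++ Γ₂) ] include Γ₀ b ≡ z) ⊎ z ≡ cutAtom Γ₀ ⊎ z ≡ cutDual Γ₀
  leaf-view []       (inj₁ (inj₁ here)) = inj₂ (inj₁ refl)
  leaf-view []       (inj₁ (inj₂ here)) = inj₂ (inj₂ refl)
  leaf-view []       (inj₂ r)           = inj₁ (r , refl)
  leaf-view (t ∷ Γ₀) (inj₁ x)           = inj₁ (inj₁ x , refl)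
  leaf-view (t ∷ Γ₀) (inj₂ z) with leaf-view Γ₀ z
  ... | inj₁ (b , e)   = inj₁ (inj₂ b , cong inj₂ e)
  ... | inj₂ (inj₁ e) = inj₂ (inj₁ (cong inj₂ e))
  ... | inj₂ (inj₂ e) = inj₂ (inj₂ (cong inj₂ e))

  cutAtom-cross⁻ : ∀ Γ₀ z → Cross _ (cutAtom Γ₀) z → z ≡ cutDual Γ₀
  cutAtom-cross⁻ []       (inj₁ (inj₂ here)) c = refl
  cutAtom-cross⁻ []       (inj₁ (inj₁ here)) ()
  cutAtom-cross⁻ []       (inj₂ r)           ()
  cutAtom-cross⁻ (t ∷ Γ₀) (inj₁ x)           ()
  cutAtom-cross⁻ (t ∷ Γ₀) (inj₂ z)           c = cong inj₂ (cutAtom-cross⁻ Γ₀ z c)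

  cutDual-cross⁻ : ∀ Γ₀ z → Cross _ (cutDual Γ₀) z → z ≡ cutAtom Γ₀
  cutDual-cross⁻ []       (inj₁ (inj₁ here)) c = refl
  cutDual-cross⁻ []       (inj₁ (inj₂ here)) ()
  cutDual-cross⁻ []       (inj₂ r)           ()
  cutDual-cross⁻ (t ∷ Γ₀) (inj₁ x)           ()
  cutDual-cross⁻ (t ∷ Γ₀) (inj₂ z)           c = cong inj₂ (cutDual-cross⁻ Γ₀ z c)

  cutAtom-cross : ∀ Γ₀ → Cross _ (cutAtom Γ₀) (cutDual Γ₀)
  cutAtom-cross []       = tt
  cutAtom-cross (t ∷ Γ₀) = cutAtom-cross Γ₀

  cutDual-cross : ∀ Γ₀ → Cross _ (cutDual Γ₀) (cutAtom Γ₀)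
  cutDual-cross []       = tt
  cutDual-cross (t ∷ Γ₀) = cutDual-cross Γ₀

  include-cross⁻ : ∀ Γ₀ a z → Cross _ (include Γ₀ a) z →
                   Σ[ b ∈ FLeaf (Γ₀ ++ Γ₂) ] include Γ₀ b ≡ z × Cross (Γ₀ ++ Γ₂) a b
  include-cross⁻ []       a        (inj₁ x) ()
  include-cross⁻ []       a        (inj₂ z) c = z , refl , c
  include-cross⁻ (t ∷ Γ₀) (inj₁ x) (inj₁ y) c = inj₁ y , refl , c
  include-cross⁻ (t ∷ Γ₀) (inj₁ x) (inj₂ y) ()
  include-cross⁻ (t ∷ Γ₀) (inj₂ a) (inj₁ y) ()
  include-cross⁻ (t ∷ Γ₀) (inj₂ a) (inj₂ z) c with include-cross⁻ Γ₀ a z c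
  ... | (b , e , c′) = inj₂ b , cong inj₂ e , c′

  include-cross : ∀ Γ₀ a b → Cross (Γ₀ ++ Γ₂) a b → Cross _ (include Γ₀ a) (include Γ₀ b)
  include-cross []       a        b        c = c
  include-cross (t ∷ Γ₀) (inj₁ x) (inj₁ y) c = c
  include-cross (t ∷ Γ₀) (inj₂ x) (inj₂ y) c = include-cross Γ₀ x y c

  include-label : ∀ Γ₀ x → flabel _ (include Γ₀ x) ≡ flabel _ x
  include-label []       x        = refl
  include-label (t ∷ Γ₀) (inj₁ x) = refl
  include-label (t ∷ Γ₀) (inj₂ x) = include-label Γ₀ x

  cutAtom-label : ∀ Γ₀ → flabel _ (cutAtom Γ₀) ≡ l
  cutAtom-label []       = refl
  cutAtom-label (t ∷ Γ₀) = cutAtom-label Γ₀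

  cutDual-label : ∀ Γ₀ → flabel _ (cutDual Γ₀) ≡ dualLit l
  cutDual-label []       = refl
  cutDual-label (t ∷ Γ₀) = cutDual-label Γ₀

  extend : ∀ Γ₀ → FPruning (Γ₀ ++ Γ₂) → TPruning T → FPruning (Γ₀ ++ T ∷ Γ₂)
  extend []       p        k = k , p
  extend (t ∷ Γ₀) (q , ps) k = q , extend Γ₀ ps k

  include-kept⁻ : ∀ Γ₀ p k x → fkept _ (extend Γ₀ p k) (include Γ₀ x) → fkept _ p x
  include-kept⁻ []       p        k x        h = h
  include-kept⁻ (t ∷ Γ₀) (q , ps) k (inj₁ x) h = h
  include-kept⁻ (t ∷ Γ₀) (q , ps) k (inj₂ x) h = include-kept⁻ Γ₀ ps k x h

  cutDual-pruned : ∀ Γ₀ p → ¬ fkept _ (extend Γ₀ p (inj₁ tt)) (cutDual Γ₀)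
  cutDual-pruned []       p        ()
  cutDual-pruned (t ∷ Γ₀) (q , ps) h = cutDual-pruned Γ₀ ps h

  cutAtom-pruned : ∀ Γ₀ p → ¬ fkept _ (extend Γ₀ p (inj₂ tt)) (cutAtom Γ₀)
  cutAtom-pruned []       p        ()
  cutAtom-pruned (t ∷ Γ₀) (q , ps) h = cutAtom-pruned Γ₀ ps h

module AtomicCut (Γ₁ Γ₂ : Forest) (l : Lit)
  (Q : FLeaf (Γ₁ ++ cut (lit l) ∷ Γ₂) → FLeaf (Γ₁ ++ cut (lit l) ∷ Γ₂) → Bool) where
  open AtomicCutLeaves l Γ₂

  ι : FLeaf (Γ₁ ++ Γ₂) → FLeaf (Γ₁ ++ T ∷ Γ₂)
  ι = include Γ₁

  a ā : FLeaf (Γ₁ ++ T ∷ Γ₂)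
  a = cutAtom Γ₁
  ā = cutDual Γ₁

  Q′ : FLeaf (Γ₁ ++ Γ₂) → FLeaf (Γ₁ ++ Γ₂) → Bool
  Q′ x y = Q (ι x) (ι y) ∨ (Q (ι x) a ∧ Q ā (ι y)) ∨ (Q (ι x) ā ∧ Q a (ι y))

  π ρ : Prenet
  π = mk (Γ₁ ++ T ∷ Γ₂) Q
  ρ = mk (Γ₁ ++ Γ₂) Q′

  module _ (S : IsSimple π) where
    private
      sy : ∀ x y → Q x y ≡ Q y x
      sy = proj₁ S
      ir : ∀ x → Q x x ≡ false
      ir = proj₁ (proj₂ S)
      lb : ∀ x y → Q x y ≡ true → flabel _ y ≡ dualLit (flabel _ x)
      lb = proj₂ (proj₂ S)

    ā-link-label : ∀ {x} → Q ā (ι x) ≡ true → flabel _ (ι x) ≡ l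
    ā-link-label h = trans (lb ā _ h) (trans (cong dualLit (cutDual-label Γ₁)) (dualLit-involutive l))

    link-a-label : ∀ {x} → Q (ι x) a ≡ true → l ≡ dualLit (flabel _ (ι x))
    link-a-label h = trans (sym (cutAtom-label Γ₁)) (lb _ a h)

    link-ā-label : ∀ {x} → Q (ι x) ā ≡ true → flabel _ (ι x) ≡ l
    link-ā-label h = sym (dualLit-injective (trans (sym (cutDual-label Γ₁)) (lb _ ā h)))

    a-link-label : ∀ {x} → Q a (ι x) ≡ true → flabel _ (ι x) ≡ dualLit l
    a-link-label h = trans (lb a _ h) (cong dualLit (cutAtom-label Γ₁))

    symmetric : ∀ x y → Q′ x y ≡ Q′ y x
    symmetric x y rewrite sy (ι y) (ι x) | sy (ι y) a | sy ā (ι x) | sy (ι y) ā | sy a (ι x) =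
      ∨∧∨-swap (Q (ι x) (ι y)) (Q (ι x) a) (Q ā (ι y)) (Q (ι x) ā) (Q a (ι y))

    irreflexive : ∀ x → Q′ x x ≡ false
    irreflexive x
      rewrite ir (ι x)
            | ∧-false (Q (ι x) a) (Q ā (ι x))
                (λ h₁ h₂ → l≢dualLit l (trans (link-a-label h₁) (cong dualLit (ā-link-label h₂))))
            | ∧-false (Q (ι x) ā) (Q a (ι x))
                (λ h₁ h₂ → l≢dualLit l (trans (sym (link-ā-label h₁)) (a-link-label h₂)))
      = refl

    dual-labels : ∀ x y → Q′ x y ≡ true → flabel _ y ≡ dualLit (flabel _ x)
    dual-labels x y h =
      trans (sym (include-label Γ₁ y)) (trans (cases (∨∧∨-true⁻ _ _ _ _ _ h)) (cong dualLit (include-label Γ₁ x)))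
      where
        cases : Q (ι x) (ι y) ≡ true ⊎ (Q (ι x) a ≡ true × Q ā (ι y) ≡ true)
                                     ⊎ (Q (ι x) ā ≡ true × Q a (ι y) ≡ true) →
                flabel _ (ι y) ≡ dualLit (flabel _ (ι x))
        cases (inj₁ h₀)              = lb (ι x) (ι y) h₀
        cases (inj₂ (inj₁ (h₁ , h₂))) = trans (ā-link-label h₂) (link-a-label h₁)
        cases (inj₂ (inj₂ (h₁ , h₂))) = trans (a-link-label h₂) (cong dualLit (sym (link-ā-label h₁)))

    simple : IsSimple ρ
    simple = symmetric , irreflexive , dual-labels

    HasLink : FPruning (Γ₁ ++ Γ₂) → Set
    HasLink p = ∃[ x ] ∃[ y ] (fkept _ p x × fkept _ p y × Q′ x y ≡ true)

    link-keeping-a : ∀ p z w → fkept _ (extend Γ₁ p (inj₁ tt)) z → fkept _ (extend Γ₁ p (inj₁ tt)) w →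
                     Q z w ≡ true → HasLink p ⊎ Σ[ x ∈ _ ] fkept _ p x × Q (ι x) a ≡ true
    link-keeping-a p z w kz kw h with leaf-view Γ₁ z | leaf-view Γ₁ w
    ... | inj₁ (x , refl) | inj₁ (y , refl) =
      inj₁ (x , y , include-kept⁻ Γ₁ p _ x kz , include-kept⁻ Γ₁ p _ y kw , ∨-trueˡ _ h)
    ... | inj₁ (x , refl) | inj₂ (inj₁ refl) = inj₂ (x , include-kept⁻ Γ₁ p _ x kz , h)
    ... | inj₂ (inj₁ refl) | inj₁ (y , refl) = inj₂ (y , include-kept⁻ Γ₁ p _ y kw , trans (sy _ _) h)
    ... | inj₂ (inj₁ refl) | inj₂ (inj₁ refl) = ⊥-elim (true≢false (trans (sym h) (ir _)))
    ... | _                | inj₂ (inj₂ refl) = ⊥-elim (cutDual-pruned Γ₁ p kw)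
    ... | inj₂ (inj₂ refl) | _                = ⊥-elim (cutDual-pruned Γ₁ p kz)

    link-keeping-ā : ∀ p z w → fkept _ (extend Γ₁ p (inj₂ tt)) z → fkept _ (extend Γ₁ p (inj₂ tt)) w →
                     Q z w ≡ true → HasLink p ⊎ Σ[ y ∈ _ ] fkept _ p y × Q ā (ι y) ≡ true
    link-keeping-ā p z w kz kw h with leaf-view Γ₁ z | leaf-view Γ₁ w
    ... | inj₁ (x , refl) | inj₁ (y , refl) =
      inj₁ (x , y , include-kept⁻ Γ₁ p _ x kz , include-kept⁻ Γ₁ p _ y kw , ∨-trueˡ _ h)
    ... | inj₁ (x , refl) | inj₂ (inj₂ refl) = inj₂ (x , include-kept⁻ Γ₁ p _ x kz , trans (sy _ _) h)
    ... | inj₂ (inj₂ refl) | inj₁ (y , refl) = inj₂ (y , include-kept⁻ Γ₁ p _ y kw , h)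
    ... | inj₂ (inj₂ refl) | inj₂ (inj₂ refl) = ⊥-elim (true≢false (trans (sym h) (ir _)))
    ... | _                | inj₂ (inj₁ refl) = ⊥-elim (cutAtom-pruned Γ₁ p kw)
    ... | inj₂ (inj₁ refl) | _                = ⊥-elim (cutAtom-pruned Γ₁ p kz)

    -- Prune the cut to a and to ā in turn; unless one of the two links found
    -- avoids the cut, they are x–a and ā–y, and x–y is a new link.
    correct : Correct π → Correct ρ
    correct c p with c (extend Γ₁ p (inj₁ tt)) | c (extend Γ₁ p (inj₂ tt))
    ... | (z , w , kz , kw , h) | (z′ , w′ , kz′ , kw′ , h′)
        with link-keeping-a p z w kz kw h | link-keeping-ā p z′ w′ kz′ kw′ h′
    ... | inj₁ r              | _                  = r
    ... | inj₂ _              | inj₁ r             = r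
    ... | inj₂ (x , kx , hx) | inj₂ (y , ky , hy) = x , y , kx , ky , ∨∧∨-true₂ (Q (ι x) (ι y)) _ hx hy

    open AtomicCutPaths Q (Cross _) (Cross (Γ₁ ++ Γ₂)) ι a ā (leaf-view Γ₁)
           (cutAtom-cross⁻ Γ₁) (cutDual-cross⁻ Γ₁) (cutAtom-cross Γ₁) (cutDual-cross Γ₁)
           (include-cross⁻ Γ₁) (include-cross Γ₁) (ir a) (ir ā) using (to; from)
    open FrameLift [] (T ∷ []) Γ₂ ι∅ using (outer-frame; frame-embOuter)

    simulation : Simulation π ρ
    simulation = record
      { back          = ι
      ; outer≡        = outer-frame refl Γ₁
      ; back-embOuter = frame-embOuter refl (λ _ → refl) Γ₁
      ; path-back     = to
      ; path-forth    = from
      }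

⟶-simple : ∀ {π ρ} → IsSimple π → π ⟶ ρ → IsSimple ρ
⟶-simple S (∧-red Γ₁ Γ₂ A B Q)  = ∧-Cut.simple A B Γ₁ Γ₂ Q S
⟶-simple S (∨-red Γ₁ Γ₂ A B Q)  = ∨-Cut.simple A B Γ₁ Γ₂ Q S
⟶-simple S (atom-red Γ₁ Γ₂ l Q) = AtomicCut.simple Γ₁ Γ₂ l Q S

⟶-correct : ∀ {π ρ} → IsSimple π → Correct π → π ⟶ ρ → Correct ρ
⟶-correct S c (∧-red Γ₁ Γ₂ A B Q)  = ∧-Cut.correct A B Γ₁ Γ₂ Q c
⟶-correct S c (∨-red Γ₁ Γ₂ A B Q)  = ∨-Cut.correct A B Γ₁ Γ₂ Q c
⟶-correct S c (atom-red Γ₁ Γ₂ l Q) = AtomicCut.correct Γ₁ Γ₂ l Q S c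

⟶-simulation : ∀ {π ρ} → IsSimple π → π ⟶ ρ → Simulation π ρ
⟶-simulation S (∧-red Γ₁ Γ₂ A B Q)  = ∧-Cut.simulation A B Γ₁ Γ₂ Q
⟶-simulation S (∨-red Γ₁ Γ₂ A B Q)  = ∨-Cut.simulation A B Γ₁ Γ₂ Q
⟶-simulation S (atom-red Γ₁ Γ₂ l Q) = AtomicCut.simulation Γ₁ Γ₂ l Q S

-- Termination

size : Formula → ℕ
size (lit l)  = 1
size (A ∨ᶠ B) = suc (size A + size B)
size (A ∧ᶠ B) = suc (size A + size B)

cutSize : Forest → ℕ
cutSize []          = 0
cutSize (fml F ∷ Γ) = cutSize Γ
cutSize (cut A ∷ Γ) = size A + cutSize Γ

cutSize-++ : ∀ Δ Θ → cutSize (Δ ++ Θ) ≡ cutSize Δ + cutSize Θ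
cutSize-++ []          Θ = refl
cutSize-++ (fml F ∷ Δ) Θ = cutSize-++ Δ Θ
cutSize-++ (cut A ∷ Δ) Θ =
  trans (cong (size A +_) (cutSize-++ Δ Θ)) (sym (+-assoc (size A) (cutSize Δ) (cutSize Θ)))

cutSize-split< : ∀ A B X Γ₁ Γ₂ → size X ≡ suc (size A + size B) →
                 cutSize (Γ₁ ++ cut A ∷ cut B ∷ Γ₂) < cutSize (Γ₁ ++ cut X ∷ Γ₂)
cutSize-split< A B X Γ₁ Γ₂ e
  rewrite cutSize-++ Γ₁ (cut A ∷ cut B ∷ Γ₂) | cutSize-++ Γ₁ (cut X ∷ Γ₂) | e =
  +-monoʳ-< (cutSize Γ₁) (s≤s (≤-reflexive (sym (+-assoc (size A) (size B) (cutSize Γ₂)))))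

⟶-cutSize : ∀ {π ρ} → π ⟶ ρ → cutSize (Γ ρ) < cutSize (Γ π)
⟶-cutSize (∧-red Γ₁ Γ₂ A B Q) = cutSize-split< A B (A ∧ᶠ B) Γ₁ Γ₂ refl
⟶-cutSize (∨-red Γ₁ Γ₂ A B Q) = cutSize-split< A B (A ∨ᶠ B) Γ₁ Γ₂ refl
⟶-cutSize (atom-red Γ₁ Γ₂ l Q)
  rewrite cutSize-++ Γ₁ Γ₂ | cutSize-++ Γ₁ (cut (lit l) ∷ Γ₂) = +-monoʳ-< (cutSize Γ₁) (n<1+n (cutSize Γ₂))

stronglyNormalizing : ∀ π → StronglyNormalizing π
stronglyNormalizing =
  Subrelation.wellFounded ⟶-cutSize (wellFounded (cutSize ∘ Γ) <-wellFounded)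

-- Confluence

cutFree⊎redex : ∀ Γ₀ → CutFree Γ₀ ⊎ Σ[ Γ₁ ∈ Forest ] Σ[ Γ₂ ∈ Forest ] Σ[ X ∈ Formula ] Γ₀ ≡ Γ₁ ++ cut X ∷ Γ₂
cutFree⊎redex []          = inj₁ []
cutFree⊎redex (cut X ∷ Γ) = inj₂ ([] , Γ , X , refl)
cutFree⊎redex (fml F ∷ Γ) with cutFree⊎redex Γ
... | inj₁ cf                  = inj₁ (F ∷ cf)
... | inj₂ (Γ₁ , Γ₂ , X , e) = inj₂ (fml F ∷ Γ₁ , Γ₂ , X , cong (fml F ∷_) e)

redex-step : ∀ Γ₁ Γ₂ X Q → Σ[ ρ ∈ Prenet ] mk (Γ₁ ++ cut X ∷ Γ₂) Q ⟶ ρ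
redex-step Γ₁ Γ₂ (lit l)  Q = _ , atom-red Γ₁ Γ₂ l Q
redex-step Γ₁ Γ₂ (A ∨ᶠ B) Q = _ , ∨-red Γ₁ Γ₂ A B Q
redex-step Γ₁ Γ₂ (A ∧ᶠ B) Q = _ , ∧-red Γ₁ Γ₂ A B Q

normalise : ∀ {π} → StronglyNormalizing π → Σ[ σ ∈ Prenet ] π ⟶* σ × CutFree (Γ σ)
normalise {mk Γ₀ Q} (acc rs) with cutFree⊎redex Γ₀
... | inj₁ cf = mk Γ₀ Q , ε , cf
... | inj₂ (Γ₁ , Γ₂ , X , refl) with redex-step Γ₁ Γ₂ X Q
...   | (ρ , s) with normalise (rs s)
...     | (σ , ss , cf) = σ , s ◅ ss , cf

SamePaths : Prenet → Prenet → Set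
SamePaths π σ = Σ[ e ∈ outer (Γ σ) ≡ outer (Γ π) ] ∀ o o′ →
  NetPath σ (embOuter _ o) (embOuter _ o′) ⇔
  NetPath π (embOuter _ (subst FLeaf e o)) (embOuter _ (subst FLeaf e o′))

simulation-samePaths : ∀ {π ρ σ} → Simulation π ρ → SamePaths ρ σ → SamePaths π σ
simulation-samePaths {π} sim (e , paths) = trans e outer≡ , λ o o′ →
  mk⇔ (λ p → subst₂ (NetPath π) (back-emb o) (back-emb o′) (path-back (Equivalence.to (paths o o′) p)))
      (λ p → Equivalence.from (paths o o′)
               (path-forth (subst₂ (NetPath π) (sym (back-emb o)) (sym (back-emb o′)) p)))
  where
    open Simulation sim
    back-emb : ∀ o → back (embOuter _ (subst FLeaf e o)) ≡ embOuter _ (subst FLeaf (trans e outer≡) o)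
    back-emb o = trans (back-embOuter _) (cong (embOuter _) (subst-subst e))

⟶*-samePaths : ∀ {π σ} → IsSimple π → π ⟶* σ → SamePaths π σ
⟶*-samePaths S ε        = refl , λ _ _ → ⇔-id _
⟶*-samePaths S (s ◅ ss) = simulation-samePaths (⟶-simulation S s) (⟶*-samePaths (⟶-simple S s) ss)

outer-cutFree : ∀ {Γ₀} → CutFree Γ₀ → outer Γ₀ ≡ Γ₀
outer-cutFree []       = refl
outer-cutFree (F ∷ cf) = cong (fml F ∷_) (outer-cutFree cf)

embOuter-cutFree : ∀ {Γ₀} (cf : CutFree Γ₀) o → embOuter Γ₀ o ≡ subst FLeaf (outer-cutFree cf) o
embOuter-cutFree (F ∷ cf) (inj₁ x) = sym (subst-∷-inj₁ {fml F} (outer-cutFree cf) x)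
embOuter-cutFree (F ∷ cf) (inj₂ o) =
  trans (cong inj₂ (embOuter-cutFree cf o)) (sym (subst-∷-inj₂ {fml F} (outer-cutFree cf) o))

cutFree-¬cross : ∀ {Γ₀} → CutFree Γ₀ → ∀ x y → ¬ Cross Γ₀ x y
cutFree-¬cross (F ∷ cf) (inj₁ x) (inj₁ y) ()
cutFree-¬cross (F ∷ cf) (inj₂ x) (inj₂ y) c = cutFree-¬cross cf x y c

cutFree-path⇒link : ∀ σ → CutFree (Γ σ) → ∀ {x y} → NetPath σ x y → P σ x y ≡ true
cutFree-path⇒link σ cf (link h)           = h
cutFree-path⇒link σ cf (link-cross _ c _) = ⊥-elim (cutFree-¬cross cf _ _ c)

NormalLinks : Prenet → Prenet → Set
NormalLinks π σ = Σ[ H ∈ Γ σ ≡ outer (Γ π) ] ∀ x y →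
  P σ x y ≡ true ⇔ NetPath π (embOuter _ (subst FLeaf H x)) (embOuter _ (subst FLeaf H y))

samePaths-normalLinks : ∀ {π σ} → SamePaths π σ → CutFree (Γ σ) → NormalLinks π σ
samePaths-normalLinks {π} {σ} (e , paths) cf = trans (sym c) e , λ x y →
  mk⇔ (λ h → subst₂ Path′ (subst-c x) (subst-c y)
                 (Equivalence.to (paths _ _) (subst₂ (NetPath σ) (sym (emb-c x)) (sym (emb-c y)) (link h))))
      (λ p → cutFree-path⇒link σ cf (subst₂ (NetPath σ) (emb-c x) (emb-c y)
                 (Equivalence.from (paths _ _) (subst₂ Path′ (sym (subst-c x)) (sym (subst-c y)) p))))
  where
    c : outer (Γ σ) ≡ Γ σ
    c = outer-cutFree cf
    Path′ : FLeaf (outer (Γ π)) → FLeaf (outer (Γ π)) → Set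
    Path′ u v = NetPath π (embOuter _ u) (embOuter _ v)
    emb-c : ∀ x → embOuter _ (subst FLeaf (sym c) x) ≡ x
    emb-c x = trans (embOuter-cutFree cf _) (subst-subst-sym c)
    subst-c : ∀ x → subst FLeaf e (subst FLeaf (sym c) x) ≡ subst FLeaf (trans (sym c) e) x
    subst-c x = subst-subst (sym c)

normal-forms-≈ : ∀ {π σ₁ σ₂} → NormalLinks π σ₁ → NormalLinks π σ₂ → σ₁ ≈ σ₂
normal-forms-≈ {π} {σ₁} {σ₂} (H₁ , links₁) (H₂ , links₂) = E , λ x y →
  ≡true-⇔⇒≡ (λ h → Equivalence.from (links₂ _ _) (subst₂ Path′ (sym (move x)) (sym (move y)) (Equivalence.to (links₁ x y) h)))
             (λ h → Equivalence.from (links₁ x y) (subst₂ Path′ (move x) (move y) (Equivalence.to (links₂ _ _) h)))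
  where
    E : Γ σ₁ ≡ Γ σ₂
    E = trans H₁ (sym H₂)
    Path′ : FLeaf (outer (Γ π)) → FLeaf (outer (Γ π)) → Set
    Path′ u v = NetPath π (embOuter _ u) (embOuter _ v)
    cancel : ∀ {A : Set} {u v w : A} (p : u ≡ v) (q : w ≡ v) → trans (trans p (sym q)) q ≡ p
    cancel refl refl = refl
    move : ∀ x → subst FLeaf H₂ (subst FLeaf E x) ≡ subst FLeaf H₁ x
    move x = trans (subst-subst E) (cong (λ q → subst FLeaf q x) (cancel H₁ H₂))

theorem5p9 :
    -- cut elimination preserves correctness (and simplicity)
    (∀ π π' → SimpleProofNet π → π ⟶ π' → SimpleProofNet π') ×
    -- confluence
    (∀ π ρ₁ ρ₂ → SimpleProofNet π → π ⟶* ρ₁ → π ⟶* ρ₂ →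
       ∃[ σ₁ ] ∃[ σ₂ ] (ρ₁ ⟶* σ₁ × ρ₂ ⟶* σ₂ × σ₁ ≈ σ₂)) ×
    -- termination (strong normalisation)
    (∀ π → SimpleProofNet π → StronglyNormalizing π)
theorem5p9 = preservation , confluence , λ π _ → stronglyNormalizing π
  where
    preservation : ∀ π π′ → SimpleProofNet π → π ⟶ π′ → SimpleProofNet π′
    preservation π π′ (S , c) s = ⟶-simple S s , ⟶-correct S c s

    confluence : ∀ π ρ₁ ρ₂ → SimpleProofNet π → π ⟶* ρ₁ → π ⟶* ρ₂ →
                 ∃[ σ₁ ] ∃[ σ₂ ] (ρ₁ ⟶* σ₁ × ρ₂ ⟶* σ₂ × σ₁ ≈ σ₂)
    confluence π ρ₁ ρ₂ (S , _) r₁ r₂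
      with normalise (stronglyNormalizing ρ₁) | normalise (stronglyNormalizing ρ₂)
    ... | (σ₁ , t₁ , cf₁) | (σ₂ , t₂ , cf₂) =
      σ₁ , σ₂ , t₁ , t₂ ,
      normal-forms-≈ (samePaths-normalLinks (⟶*-samePaths S (r₁ ◅◅ t₁)) cf₁)
                     (samePaths-normalLinks (⟶*-samePaths S (r₂ ◅◅ t₂)) cf₂)
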